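{- Let $q\geq 2$ be a fixed integer. Then \[ \liminf_{n\rightarrow\infty}\frac{C(n,q)}{q^n/n}\geq \frac{(q-1)^2(2q-1)}{4q^4}. \]
   Context: Let $F$ be a finite alphabet with $|F|=q$. Two words $u,v\in F^n$ (not necessarily distinct) are overlapping if a non-empty proper prefix of $u$ equals a non-empty proper suffix of $v$, or a non-empty proper prefix of $v$ equals a non-empty proper suffix of $u$. A code $C\subseteq F^n$ is non-overlapping if for all (not necessarily distinct) $u,v\in C$, the words $u$ and $v$ are not overlapping. $C(n,q)$ denotes the maximum cardinality of a non-overlapping code $C\subseteq F^n$ with $|F|=q$. -}

module Defs where

open import Data.Nat using (ℕ; zero; suc; _∸_; _<_)
open import Data.Fin using (Fin)
open import Data.Vec using (Vec; toList)
open import Data.List using (List; take; drop; length)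
open import Data.List.Relation.Unary.Unique.Propositional using (Unique)
open import Data.List.Membership.Propositional using (_∈_)
open import Data.Product using (Σ; ∃; ∃-syntax; _×_)
open import Data.Sum using (_⊎_)
open import Relation.Nullary using (¬_)
open import Relation.Binary.PropositionalEquality using (_≡_)
open import Data.Integer using (+_)
open import Data.Rational using (ℚ; _/_; 0ℚ)

Word : ℕ → ℕ → Set
Word q n = Vec (Fin q) n

PrefixSuffix : ∀ {q n} → Word q n → Word q n → Set
PrefixSuffix {q} {n} u v =
  ∃[ k ] (0 < k × k < n × take k (toList u) ≡ drop (n ∸ k) (toList v))

Overlapping : ∀ {q n} → Word q n → Word q n → Set
Overlapping u v = PrefixSuffix u v ⊎ PrefixSuffix v u

-- A code is a finite set of words, represented as a duplicate-free list;
-- its cardinality is the length of the list.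
NonOverlapping : ∀ {q n} → List (Word q n) → Set
NonOverlapping C = ∀ u v → u ∈ C → v ∈ C → ¬ Overlapping u v

-- IsMaxNOC q n m : m = C(n,q), the maximum cardinality of a non-overlapping code in F^n.
IsMaxNOC : ℕ → ℕ → ℕ → Set
IsMaxNOC q n m =
  (∃[ C ] (Unique C × NonOverlapping {q} {n} C × length C ≡ m)) ×
  (∀ (C : List (Word q n)) → Unique C → NonOverlapping C → length C Data.Nat.≤ m)

-- the rational a / b (b > 0 in all uses; ratio a 0 = 0 is a dummy value)
ratio : ℕ → ℕ → ℚ
ratio a zero = 0ℚ
ratio a (suc b) = (+ a) / suc b

module Submission where

-- The words 0ᵏ a y b with a, b nonzero letters and y free of runs of k zeros form a
-- non-overlapping code: a proper prefix of length at most k consists of zeros while every codeword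
-- ends in a nonzero letter, and a longer prefix begins with 0ᵏ, which occurs in no codeword after
-- its first position. The recurrence for words with bounded runs of zeros shows that at least
-- qᴸ (1 − (L + 1)/qᵏ) words y of length L = n − k − 2 qualify, so C(n,q) n / qⁿ ≥ (q − 1)²/q² · x (1 − x)
-- with x = n / qᵏ. Choosing k with 2n ≤ qᵏ ≤ 2qn puts x in [1/(2q), 1/2], where
-- x (1 − x) ≥ (2q − 1)/(4q²). This works for every n ≥ 8, so the bound holds even without the ε.

open import Defs
open import Data.Nat using (ℕ; _≤_; _*_; _^_; _∸_)
open import Data.Product using (∃-syntax)
open import Data.Rational using (ℚ; Positive; _-_) renaming (_≤_ to _≤ℚ_)

open import Data.Nat using (zero; suc; _+_; _<_; _⊓_; z≤n; s≤s; z<s; NonZero; >-nonZero; s≤s⁻¹)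
open import Data.Nat.Properties
open import Data.Nat.Tactic.RingSolver using (solve-∀)
open import Data.Fin using (Fin; zero; suc)
import Data.Fin.Properties as Finₚ
open import Data.Vec using (Vec; []; _∷_; toList)
import Data.Vec as V
import Data.Vec.Properties as Vₚ
open import Data.List
  using (List; []; _∷_; _++_; _∷ʳ_; [_]; map; replicate; take; drop; length; allFin; cartesianProduct; cartesianProductWith)
import Data.List.Properties as Lₚ
open import Data.List.Membership.Propositional using (_∈_)
open import Data.List.Membership.Propositional.Properties using (∈-++⁻; ∈-map⁻; ∈-cartesianProductWith⁻)
open import Data.List.Relation.Binary.Disjoint.Propositional using (Disjoint)
open import Data.List.Relation.Unary.All using ([])
open import Data.List.Relation.Unary.AllPairs using ([]; _∷_)
open import Data.List.Relation.Unary.Unique.Propositional using (Unique)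
import Data.List.Relation.Unary.Unique.Propositional.Properties as Uniqueₚ
open import Data.Product using (_×_; _,_; uncurry)
open import Data.Sum using (inj₁; inj₂)
import Data.Integer as ℤ
import Data.Integer.Properties as ℤₚ
open import Data.Rational using (0ℚ; -_)
import Data.Rational.Properties as ℚₚ
open import Data.Rational.Unnormalised using (mkℚᵘ; *≤*)
import Data.Rational.Unnormalised.Properties as ℚᵘₚ
open import Function using (id)
open import Relation.Nullary using (¬_; yes; no; contradiction)
open import Relation.Binary.PropositionalEquality hiding ([_])

-- (T − Q) (T − c Q) ≤ 0, with both sides moved so that no subtraction occurs.
between-roots : ∀ c Q T → Q ≤ T → T ≤ c * Q → c * Q * Q + T * T ≤ T * (c * Q + Q)
between-roots c Q T Q≤T T≤cQ with b , T+b≡cQ ← m≤n⇒∃[o]m+o≡n T≤cQ = begin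
  c * Q * Q + T * T      ≡⟨ cong (λ x → x * Q + T * T) T+b≡cQ ⟨
  (T + b) * Q + T * T    ≡⟨ e₁ T b Q ⟩
  T * Q + b * Q + T * T  ≤⟨ +-monoˡ-≤ (T * T) (+-monoʳ-≤ (T * Q) (*-monoʳ-≤ b Q≤T)) ⟩
  T * Q + b * T + T * T  ≡⟨ e₂ T b Q ⟩
  T * (T + b + Q)        ≡⟨ cong (λ x → T * (x + Q)) T+b≡cQ ⟩
  T * (c * Q + Q)        ∎
  where
  open ≤-Reasoning
  e₁ : ∀ T b Q → (T + b) * Q + T * T ≡ T * Q + b * Q + T * T
  e₁ = solve-∀
  e₂ : ∀ T b Q → T * Q + b * T + T * T ≡ T * (T + b + Q)
  e₂ = solve-∀

-- g ≥ A (1 − x) for x = n / Q ∈ [1/(2q), 1/2], where x (1 − x) ≥ (2q − 1)/(4q²); here q = p + 1.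
density-bound : ∀ p n g A Q → 0 < Q → A * Q ≤ g * Q + n * A →
  2 * n ≤ Q → Q ≤ suc p * (2 * n) → (p + suc p) * (Q * A) ≤ 4 * (suc p * suc p) * (n * g)
density-bound p n g A Q 0<Q AQ≤gQ+nA 2n≤Q Q≤2qn =
  *-cancelʳ-≤ _ _ Q {{>-nonZero 0<Q}} (+-cancelʳ-≤ (T * T * A) _ _ (begin
    (p + q) * (Q * A) * Q + T * T * A  ≡⟨ e₁ p T Q A ⟩
    ((p + q) * Q * Q + T * T) * A      ≤⟨ *-monoˡ-≤ A (between-roots (p + q) Q T Q≤2qn T≤[p+q]Q) ⟩
    T * ((p + q) * Q + Q) * A          ≡⟨ e₂ p T Q A ⟩
    2 * q * T * (A * Q)                ≤⟨ *-monoʳ-≤ (2 * q * T) AQ≤gQ+nA ⟩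
    2 * q * T * (g * Q + n * A)        ≡⟨ e₃ p n g A Q ⟩
    4 * (q * q) * (n * g) * Q + T * T * A ∎))
  where
  open ≤-Reasoning
  q T : ℕ
  q = suc p
  T = q * (2 * n)
  T≤[p+q]Q : T ≤ (p + q) * Q
  T≤[p+q]Q = ≤-trans (*-monoʳ-≤ q 2n≤Q) (*-monoˡ-≤ Q (m≤n+m q p))
  e₁ : ∀ p T Q A → (p + suc p) * (Q * A) * Q + T * T * A ≡ ((p + suc p) * Q * Q + T * T) * A
  e₁ = solve-∀
  e₂ : ∀ p T Q A → T * ((p + suc p) * Q + Q) * A ≡ 2 * suc p * T * (A * Q)
  e₂ = solve-∀
  e₃ : ∀ p n g A Q → 2 * suc p * (suc p * (2 * n)) * (g * Q + n * A)
                     ≡ 4 * (suc p * suc p) * (n * g) * Q + suc p * (2 * n) * (suc p * (2 * n)) * A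
  e₃ = solve-∀

-- The inductive step of #runBounded-lower below, with A = qᴸ, Q = qᵏ and R = qʳ.
count-step : ∀ p A Q x y R L →
  A * Q ≤ x * Q + A * (suc p * R) + L * A → A * Q ≤ y * Q + A * 1 + L * A →
  suc p * A * Q ≤ (x + p * y) * Q + suc p * A * R + suc L * (suc p * A)
count-step p A Q x y R L h₁ h₂ = begin
  suc p * A * Q                                                        ≡⟨ e₁ p A Q ⟩
  A * Q + p * (A * Q)                                                  ≤⟨ +-mono-≤ h₁ (*-monoʳ-≤ p h₂) ⟩
  (x * Q + A * (suc p * R) + L * A) + p * (y * Q + A * 1 + L * A)      ≤⟨ m≤m+n _ A ⟩
  (x * Q + A * (suc p * R) + L * A) + p * (y * Q + A * 1 + L * A) + A  ≡⟨ e₂ p A Q x y R L ⟩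
  (x + p * y) * Q + suc p * A * R + suc L * (suc p * A)                ∎
  where
  open ≤-Reasoning
  e₁ : ∀ p A Q → suc p * A * Q ≡ A * Q + p * (A * Q)
  e₁ = solve-∀
  e₂ : ∀ p A Q x y R L →
       (x * Q + A * (suc p * R) + L * A) + p * (y * Q + A * 1 + L * A) + A
       ≡ (x + p * y) * Q + suc p * A * R + suc L * (suc p * A)
  e₂ = solve-∀

power-between : ∀ {q} → 2 ≤ q → ∀ x → 0 < x → ∃[ k ] (x ≤ q ^ k × q ^ k < q * x)
power-between {q} 2≤q (suc zero) _ = 0 , ≤-refl , ≤-trans 2≤q (≤-reflexive (sym (*-identityʳ q)))
power-between {q} 2≤q (suc (suc x)) _ with power-between 2≤q (suc x) z<s
... | k , 1+x≤qᵏ , qᵏ<q[1+x] with suc (suc x) ≤? q ^ k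
...   | yes 2+x≤qᵏ = k , 2+x≤qᵏ , <-≤-trans qᵏ<q[1+x] (*-monoʳ-≤ q (n≤1+n (suc x)))
...   | no 2+x≰qᵏ = suc k , 2+x≤q*qᵏ , *-monoʳ-< q (s≤s (≤-reflexive qᵏ≡1+x))
  where
  instance
    q≢0 : NonZero q
    q≢0 = >-nonZero (≤-trans (s≤s z≤n) 2≤q)
  qᵏ≡1+x : q ^ k ≡ suc x
  qᵏ≡1+x = ≤-antisym (s≤s⁻¹ (≰⇒> 2+x≰qᵏ)) 1+x≤qᵏ
  2+x≤q*qᵏ : suc (suc x) ≤ q * q ^ k
  2+x≤q*qᵏ = begin
    suc (suc x) ≤⟨ m<m*n (suc x) q 2≤q ⟩
    suc x * q   ≡⟨ *-comm (suc x) q ⟩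
    q * suc x   ≡⟨ cong (q *_) qᵏ≡1+x ⟨
    q * q ^ k   ∎
    where open ≤-Reasoning

9+i≤2^[5+i] : ∀ i → 9 + i ≤ 2 ^ (5 + i)
9+i≤2^[5+i] zero    = m≤m+n 9 23
9+i≤2^[5+i] (suc i) = begin
  1 + (9 + i)                    ≤⟨ +-mono-≤ (m^n>0 2 (5 + i)) (9+i≤2^[5+i] i) ⟩
  2 ^ (5 + i) + 2 ^ (5 + i)      ≡⟨ cong (λ z → 2 ^ (5 + i) + z) (+-identityʳ _) ⟨
  2 ^ (5 + suc i)                ∎
  where open ≤-Reasoning

small-exponent : ∀ {q} → 2 ≤ q → ∀ j n → 8 ≤ n → q ^ j < 2 * n → j + 3 ≤ n
small-exponent {q} 2≤q j n 8≤n qʲ<2n with j ≤? 5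
... | yes j≤5 = ≤-trans (+-monoˡ-≤ 3 j≤5) 8≤n
... | no j≰5 with i , refl ← m≤n⇒∃[o]m+o≡n (≰⇒> j≰5) =
  ≤-trans (≤-reflexive (cong (6 +_) (+-comm i 3))) (<⇒≤ (*-cancelˡ-< 2 (9 + i) n (begin-strict
    2 * (9 + i)         ≤⟨ *-monoʳ-≤ 2 (9+i≤2^[5+i] i) ⟩
    2 * 2 ^ (5 + i)     ≤⟨ ^-monoˡ-≤ (6 + i) 2≤q ⟩
    q ^ (6 + i)         <⟨ qʲ<2n ⟩
    2 * n               ∎)))
  where open ≤-Reasoning

block-length : ∀ {q} → 2 ≤ q → ∀ n → 8 ≤ n →
  ∃[ k′ ] ∃[ L ] (suc k′ + suc (suc L) ≡ n × 2 * n ≤ q ^ suc k′ × q ^ suc k′ ≤ q * (2 * n))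
block-length {q} 2≤q n 8≤n with power-between 2≤q (2 * n) (≤-trans (s≤s z≤n) (*-monoʳ-≤ 2 8≤n))
... | zero , 2n≤1 , _ = contradiction 2n≤1 (<⇒≱ (≤-trans (s≤s (s≤s z≤n)) (*-monoʳ-≤ 2 8≤n)))
... | suc j , 2n≤qᵏ , qᵏ<q*2n
  with L , j+3+L≡n ← m≤n⇒∃[o]m+o≡n (small-exponent 2≤q j n 8≤n (*-cancelˡ-< q (q ^ j) (2 * n) qᵏ<q*2n)) =
  j , L , trans (e j L) j+3+L≡n , 2n≤qᵏ , <⇒≤ qᵏ<q*2n
  where
  e : ∀ j L → suc j + suc (suc L) ≡ j + 3 + L
  e = solve-∀

length-cartesianProductWith : ∀ {A B C : Set} (f : A → B → C) xs ys →
  length (cartesianProductWith f xs ys) ≡ length xs * length ys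
length-cartesianProductWith f []       ys = refl
length-cartesianProductWith f (x ∷ xs) ys = begin
  length (map (f x) ys ++ cartesianProductWith f xs ys)          ≡⟨ Lₚ.length-++ (map (f x) ys) ⟩
  length (map (f x) ys) + length (cartesianProductWith f xs ys)  ≡⟨ cong₂ _+_ (Lₚ.length-map (f x) ys)
                                                                      (length-cartesianProductWith f xs ys) ⟩
  length ys + length xs * length ys                              ∎
  where open ≡-Reasoning

module _ {A : Set} where

  take-replicate-++ : ∀ (x : A) {j m} ys → j ≤ m → take j (replicate m x ++ ys) ≡ replicate j x
  take-replicate-++ x {zero}          ys _         = refl
  take-replicate-++ x {suc j} {suc m} ys (s≤s j≤m) = cong (x ∷_) (take-replicate-++ x ys j≤m)

  drop-∷ʳ : ∀ {d} (xs : List A) y → d ≤ length xs → drop d (xs ∷ʳ y) ≡ drop d xs ∷ʳ y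
  drop-∷ʳ {zero}  xs       y _         = refl
  drop-∷ʳ {suc d} (x ∷ xs) y (s≤s d≤n) = drop-∷ʳ xs y d≤n

  replicate≢∷ʳ : ∀ {x y : A} → x ≢ y → ∀ j xs → replicate j x ≢ xs ∷ʳ y
  replicate≢∷ʳ x≢y zero    []      ()
  replicate≢∷ʳ x≢y zero    (_ ∷ _) ()
  replicate≢∷ʳ x≢y (suc j) []      eq = x≢y (Lₚ.∷-injectiveˡ eq)
  replicate≢∷ʳ x≢y (suc j) (_ ∷ xs) eq = replicate≢∷ʳ x≢y j xs (Lₚ.∷-injectiveʳ eq)

module ZeroBlockCode (p k′ : ℕ) where

  q k : ℕ
  q = suc p
  k = suc k′

  -- RunBounded s xs: xs begins with at most s zeros, and every later run of zeros has length at most k′.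
  data RunBounded : ℕ → List (Fin q) → Set where
    empty    : ∀ {s} → RunBounded s []
    zero∷    : ∀ {s xs} → RunBounded s xs → RunBounded (suc s) (zero ∷ xs)
    nonzero∷ : ∀ {s i xs} → RunBounded k′ xs → RunBounded s (suc i ∷ xs)

  RunBounded-∷ʳ : ∀ {s xs} b → RunBounded s xs → RunBounded s (xs ∷ʳ suc b)
  RunBounded-∷ʳ b empty         = nonzero∷ empty
  RunBounded-∷ʳ b (zero∷ rb)    = zero∷ (RunBounded-∷ʳ b rb)
  RunBounded-∷ʳ b (nonzero∷ rb) = nonzero∷ (RunBounded-∷ʳ b rb)

  RunBounded-replicate : ∀ {xs} m → RunBounded 0 xs → RunBounded m (replicate m zero ++ xs)
  RunBounded-replicate zero    rb = rb
  RunBounded-replicate (suc m) rb = zero∷ (RunBounded-replicate m rb)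

  zeroPrefix≤bound : ∀ {s xs} m → RunBounded s xs → take m xs ≡ replicate m zero → m ≤ s
  zeroPrefix≤bound zero    _             _  = z≤n
  zeroPrefix≤bound (suc m) empty         ()
  zeroPrefix≤bound (suc m) (zero∷ rb)    eq = s≤s (zeroPrefix≤bound m rb (Lₚ.∷-injectiveʳ eq))
  zeroPrefix≤bound (suc m) (nonzero∷ rb) ()

  noZeroBlock : ∀ {s xs} → RunBounded s xs → s ≤ k′ → ∀ d → take k (drop d xs) ≢ replicate k zero
  noZeroBlock rb            s≤k′ zero    eq = <⇒≱ (s≤s s≤k′) (zeroPrefix≤bound k rb eq)
  noZeroBlock empty         _    (suc d) ()
  noZeroBlock (zero∷ rb)    s≤k′ (suc d) = noZeroBlock rb (≤-trans (n≤1+n _) s≤k′) d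
  noZeroBlock (nonzero∷ rb) _    (suc d) = noZeroBlock rb ≤-refl d

  prependNonzero : ∀ {L} → List (Vec (Fin q) L) → List (Vec (Fin q) (suc L))
  prependNonzero = cartesianProductWith (λ i y → suc i ∷ y) (allFin p)

  runBounded : ℕ → (L : ℕ) → List (Vec (Fin q) L)
  runBounded s       zero    = [ [] ]
  runBounded zero    (suc L) = prependNonzero (runBounded k′ L)
  runBounded (suc s) (suc L) = map (zero ∷_) (runBounded s L) ++ prependNonzero (runBounded k′ L)

  #runBounded : ℕ → ℕ → ℕ
  #runBounded s L = length (runBounded s L)

  ∈-prependNonzero : ∀ {s L} {ys : List (Vec (Fin q) L)} → (∀ {y} → y ∈ ys → RunBounded k′ (toList y)) →
    ∀ {x} → x ∈ prependNonzero ys → RunBounded s (toList x)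
  ∈-prependNonzero {ys = ys} sound x∈ with ∈-cartesianProductWith⁻ _ (allFin p) ys x∈
  ... | _ , _ , _ , y∈ , refl = nonzero∷ (sound y∈)

  runBounded-sound : ∀ s L {y} → y ∈ runBounded s L → RunBounded s (toList y)
  runBounded-sound s       zero    {[]} _  = empty
  runBounded-sound zero    (suc L) y∈ = ∈-prependNonzero (runBounded-sound k′ L) y∈
  runBounded-sound (suc s) (suc L) y∈ with ∈-++⁻ (map (zero ∷_) (runBounded s L)) y∈
  ... | inj₂ y∈′ = ∈-prependNonzero (runBounded-sound k′ L) y∈′
  ... | inj₁ y∈′ with ∈-map⁻ (zero ∷_) y∈′
  ...   | _ , z∈ , refl = zero∷ (runBounded-sound s L z∈)

  prependNonzero-unique : ∀ {L} {ys : List (Vec (Fin q) L)} → Unique ys → Unique (prependNonzero ys)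
  prependNonzero-unique = Uniqueₚ.cartesianProductWith⁺ _ suc∷-injective (Uniqueₚ.allFin⁺ p)
    where
    suc∷-injective : ∀ {L} {i j : Fin p} {y z : Vec (Fin q) L} → suc i ∷ y ≡ suc j ∷ z → i ≡ j × y ≡ z
    suc∷-injective refl = refl , refl

  runBounded-unique : ∀ s L → Unique (runBounded s L)
  runBounded-unique s       zero    = [] ∷ []
  runBounded-unique zero    (suc L) = prependNonzero-unique (runBounded-unique k′ L)
  runBounded-unique (suc s) (suc L) =
    Uniqueₚ.++⁺ (Uniqueₚ.map⁺ Vₚ.∷-injectiveʳ (runBounded-unique s L))
                (prependNonzero-unique (runBounded-unique k′ L)) disjoint
    where
    disjoint : Disjoint (map (zero ∷_) (runBounded s L)) (prependNonzero (runBounded k′ L))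
    disjoint (x∈₁ , x∈₂) with ∈-map⁻ (zero ∷_) x∈₁ | ∈-cartesianProductWith⁻ _ (allFin p) _ x∈₂
    ... | _ , _ , refl | _ , _ , _ , _ , ()

  length-prependNonzero : ∀ {L} (ys : List (Vec (Fin q) L)) → length (prependNonzero ys) ≡ p * length ys
  length-prependNonzero ys =
    trans (length-cartesianProductWith _ (allFin p) ys) (cong (_* length ys) (Lₚ.length-tabulate {n = p} id))

  #runBounded-zero : ∀ L → #runBounded 0 (suc L) ≡ p * #runBounded k′ L
  #runBounded-zero L = length-prependNonzero (runBounded k′ L)

  #runBounded-suc : ∀ s L → #runBounded (suc s) (suc L) ≡ #runBounded s L + p * #runBounded k′ L
  #runBounded-suc s L = trans (Lₚ.length-++ (map (zero ∷_) (runBounded s L)))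
    (cong₂ _+_ (Lₚ.length-map (zero ∷_) (runBounded s L)) (length-prependNonzero (runBounded k′ L)))

  #runBounded-lower : ∀ L s r → s + r ≡ k′ →
    q ^ L * q ^ k ≤ #runBounded s L * q ^ k + q ^ L * q ^ r + L * q ^ L
  #runBounded-lower zero s r _ = ≤-trans (m≤m+n (1 * q ^ k) _) (m≤m+n _ _)
  #runBounded-lower (suc L) zero r refl = begin
    q ^ suc L * q ^ k
      ≤⟨ count-step p (q ^ L) (q ^ k) 0 (#runBounded k′ L) (q ^ k′) L
           (m≤m+n _ _) (#runBounded-lower L k′ 0 (+-identityʳ k′)) ⟩
    p * #runBounded k′ L * q ^ k + q ^ suc L * q ^ k′ + suc L * q ^ suc L
      ≡⟨ cong (λ g → g * q ^ k + q ^ suc L * q ^ k′ + suc L * q ^ suc L) (#runBounded-zero L) ⟨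
    #runBounded 0 (suc L) * q ^ k + q ^ suc L * q ^ k′ + suc L * q ^ suc L ∎
    where open ≤-Reasoning
  #runBounded-lower (suc L) (suc s) r s+r≡k′ = begin
    q ^ suc L * q ^ k
      ≤⟨ count-step p (q ^ L) (q ^ k) (#runBounded s L) (#runBounded k′ L) (q ^ r) L
           (#runBounded-lower L s (suc r) (trans (+-suc s r) s+r≡k′)) (#runBounded-lower L k′ 0 (+-identityʳ k′)) ⟩
    (#runBounded s L + p * #runBounded k′ L) * q ^ k + q ^ suc L * q ^ r + suc L * q ^ suc L
      ≡⟨ cong (λ g → g * q ^ k + q ^ suc L * q ^ r + suc L * q ^ suc L) (#runBounded-suc s L) ⟨
    #runBounded (suc s) (suc L) * q ^ k + q ^ suc L * q ^ r + suc L * q ^ suc L ∎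
    where open ≤-Reasoning

  codeword : ∀ {L} → Fin p → Vec (Fin q) L → Fin p → Word q (k + suc (suc L))
  codeword a y b = V.replicate k zero V.++ (suc a ∷ (y V.∷ʳ suc b))

  toList-codeword : ∀ {L} a (y : Vec (Fin q) L) b →
    toList (codeword a y b) ≡ replicate k zero ++ suc a ∷ toList y ∷ʳ suc b
  toList-codeword a y b = trans (Vₚ.toList-++ (V.replicate k zero) (suc a ∷ (y V.∷ʳ suc b)))
    (cong₂ _++_ (Vₚ.toList-replicate k zero) (cong (suc a ∷_) (Vₚ.toList-∷ʳ (suc b) y)))

  codeword-injective : ∀ {L} {a a′ : Fin p} {yb yb′ : Vec (Fin q) L × Fin p} →
    uncurry (codeword a) yb ≡ uncurry (codeword a′) yb′ → a ≡ a′ × yb ≡ yb′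
  codeword-injective {yb = y , b} {y′ , b′} eq
    with sa≡sa′ , y∷ʳb≡y′∷ʳb′ ← Vₚ.∷-injective (Vₚ.++-injectiveʳ (V.replicate k zero) (V.replicate k zero) eq)
    with refl , refl ← Vₚ.∷ʳ-injective y y′ y∷ʳb≡y′∷ʳb′ = Finₚ.suc-injective sa≡sa′ , refl

  code : ∀ L → List (Word q (k + suc (suc L)))
  code L = cartesianProductWith (λ a → uncurry (codeword a)) (allFin p) (cartesianProduct (runBounded k′ L) (allFin p))

  code-unique : ∀ L → Unique (code L)
  code-unique L = Uniqueₚ.cartesianProductWith⁺ _ codeword-injective (Uniqueₚ.allFin⁺ p)
    (Uniqueₚ.cartesianProduct⁺ (runBounded-unique k′ L) (Uniqueₚ.allFin⁺ p))

  length-code : ∀ L → length (code L) ≡ p * (#runBounded k′ L * p)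
  length-code L = trans (length-cartesianProductWith _ (allFin p) _) (cong₂ _*_ (Lₚ.length-tabulate {n = p} id)
    (trans (length-cartesianProductWith _ (runBounded k′ L) (allFin p)) (cong (#runBounded k′ L *_) (Lₚ.length-tabulate {n = p} id))))

  ∈-code⁻ : ∀ {L u} → u ∈ code L → ∃[ a ] ∃[ y ] ∃[ b ] (y ∈ runBounded k′ L × u ≡ codeword a y b)
  ∈-code⁻ {L} u∈ with ∈-cartesianProductWith⁻ _ (allFin p) _ u∈
  ... | a , (y , b) , _ , yb∈ , refl with ∈-cartesianProductWith⁻ _,_ (runBounded k′ L) (allFin p) yb∈
  ...   | _ , _ , y∈ , _ , refl = a , y , b , y∈ , refl

  prefix≢suffix : ∀ {n} ys xs (b : Fin p) → length (xs ∷ʳ suc b) ≡ n →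
    (∀ {d} → 0 < d → take k (drop d (xs ∷ʳ suc b)) ≢ replicate k zero) →
    ∀ {t} → 0 < t → t < n → take t (replicate k zero ++ ys) ≢ drop (n ∸ t) (xs ∷ʳ suc b)
  prefix≢suffix {n} ys xs b |xs∷ʳb|≡n noBlock {t} 0<t t<n eq with t ≤? k
  ... | yes t≤k = replicate≢∷ʳ (λ ()) t (drop (n ∸ t) xs) (begin
    replicate t zero                  ≡⟨ take-replicate-++ zero ys t≤k ⟨
    take t (replicate k zero ++ ys)   ≡⟨ eq ⟩
    drop (n ∸ t) (xs ∷ʳ suc b)        ≡⟨ drop-∷ʳ xs (suc b) n∸t≤|xs| ⟩
    drop (n ∸ t) xs ∷ʳ suc b          ∎)
    where
    open ≡-Reasoning
    n∸t≤|xs| : n ∸ t ≤ length xs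
    n∸t≤|xs| = ≤-trans (∸-monoʳ-≤ n 0<t) (≤-reflexive (begin
      n ∸ 1                 ≡⟨ cong (_∸ 1) |xs∷ʳb|≡n ⟨
      length (xs ∷ʳ suc b) ∸ 1 ≡⟨ cong (_∸ 1) (Lₚ.length-++ xs) ⟩
      length xs + 1 ∸ 1     ≡⟨ m+n∸n≡m (length xs) 1 ⟩
      length xs             ∎))
  ... | no t≰k = noBlock (m<n⇒0<n∸m t<n) (begin
    take k (drop (n ∸ t) (xs ∷ʳ suc b))        ≡⟨ cong (take k) eq ⟨
    take k (take t (replicate k zero ++ ys))   ≡⟨ Lₚ.take-take k t _ ⟩
    take (k ⊓ t) (replicate k zero ++ ys)      ≡⟨ cong (λ i → take i (replicate k zero ++ ys)) (m≤n⇒m⊓n≡m (<⇒≤ (≰⇒> t≰k))) ⟩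
    take k (replicate k zero ++ ys)            ≡⟨ take-replicate-++ zero ys ≤-refl ⟩
    replicate k zero                           ∎)
    where open ≡-Reasoning

  code-prefix≢suffix : ∀ {L u v} → u ∈ code L → v ∈ code L → ¬ PrefixSuffix u v
  code-prefix≢suffix {L} u∈ v∈ (t , 0<t , t<n , eq) with ∈-code⁻ u∈ | ∈-code⁻ v∈
  ... | a , y , b , _ , refl | a′ , y′ , b′ , y′∈ , refl =
    prefix≢suffix (suc a ∷ toList y ∷ʳ suc b) xs b′ |xs∷ʳb′|≡n noBlock 0<t t<n (begin
      take t (replicate k zero ++ suc a ∷ toList y ∷ʳ suc b)  ≡⟨ cong (take t) (toList-codeword a y b) ⟨
      take t (toList (codeword a y b))                       ≡⟨ eq ⟩
      drop (n ∸ t) (toList (codeword a′ y′ b′))              ≡⟨ cong (drop (n ∸ t)) v≡xs∷ʳb′ ⟩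
      drop (n ∸ t) (xs ∷ʳ suc b′)                            ∎)
    where
    open ≡-Reasoning
    n : ℕ
    n = k + suc (suc L)
    xs : List (Fin q)
    xs = replicate k zero ++ suc a′ ∷ toList y′
    reassociate : replicate k zero ++ suc a′ ∷ toList y′ ∷ʳ suc b′ ≡ xs ∷ʳ suc b′
    reassociate = sym (Lₚ.++-assoc (replicate k zero) (suc a′ ∷ toList y′) [ suc b′ ])
    v≡xs∷ʳb′ : toList (codeword a′ y′ b′) ≡ xs ∷ʳ suc b′
    v≡xs∷ʳb′ = trans (toList-codeword a′ y′ b′) reassociate
    |xs∷ʳb′|≡n : length (xs ∷ʳ suc b′) ≡ n
    |xs∷ʳb′|≡n = trans (cong length (sym v≡xs∷ʳb′)) (Vₚ.length-toList (codeword a′ y′ b′))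
    tail-bounded : RunBounded k′ (replicate k′ zero ++ suc a′ ∷ toList y′ ∷ʳ suc b′)
    tail-bounded = RunBounded-replicate k′ (nonzero∷ (RunBounded-∷ʳ b′ (runBounded-sound k′ L y′∈)))
    noBlock : ∀ {d} → 0 < d → take k (drop d (xs ∷ʳ suc b′)) ≢ replicate k zero
    noBlock {suc d} _ = subst (λ ws → take k (drop (suc d) ws) ≢ replicate k zero) reassociate
      (noZeroBlock tail-bounded ≤-refl d)

  code-nonOverlapping : ∀ L → NonOverlapping (code L)
  code-nonOverlapping L u v u∈ v∈ (inj₁ u⇝v) = code-prefix≢suffix u∈ v∈ u⇝v
  code-nonOverlapping L u v u∈ v∈ (inj₂ v⇝u) = code-prefix≢suffix v∈ u∈ v⇝u

  code-density : ∀ L → let n = k + suc (suc L) in 2 * n ≤ q ^ k → q ^ k ≤ q * (2 * n) →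
    p ^ 2 * (2 * q ∸ 1) * q ^ n ≤ length (code L) * n * (4 * q ^ 4)
  code-density L 2n≤Q Q≤2qn = begin
    p ^ 2 * (2 * q ∸ 1) * q ^ n                    ≡⟨ cong (p ^ 2 * (2 * q ∸ 1) *_) (^-distribˡ-+-* q k (suc (suc L))) ⟩
    p ^ 2 * (2 * q ∸ 1) * (Q * (q * (q * A)))      ≡⟨ e₁ p Q A ⟩
    p * p * (q * q) * ((p + q) * (Q * A))          ≤⟨ *-monoʳ-≤ (p * p * (q * q)) (density-bound p n g A Q (m^n>0 q k) AQ≤gQ+nA 2n≤Q Q≤2qn) ⟩
    p * p * (q * q) * (4 * (q * q) * (n * g))      ≡⟨ e₂ p n g ⟩
    p * (g * p) * n * (4 * q ^ 4)                  ≡⟨ cong (λ c → c * n * (4 * q ^ 4)) (length-code L) ⟨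
    length (code L) * n * (4 * q ^ 4)              ∎
    where
    open ≤-Reasoning
    n A Q g : ℕ
    n = k + suc (suc L)
    A = q ^ L
    Q = q ^ k
    g = #runBounded k′ L
    AQ≤gQ+nA : A * Q ≤ g * Q + n * A
    AQ≤gQ+nA = begin
      A * Q                   ≤⟨ #runBounded-lower L k′ 0 (+-identityʳ k′) ⟩
      g * Q + A * 1 + L * A   ≡⟨ +-assoc (g * Q) (A * 1) (L * A) ⟩
      g * Q + (A * 1 + L * A) ≡⟨ cong (λ a → g * Q + (a + L * A)) (*-identityʳ A) ⟩
      g * Q + suc L * A       ≤⟨ +-monoʳ-≤ (g * Q) (*-monoˡ-≤ A (≤-trans (n≤1+n (suc L)) (m≤n+m _ k))) ⟩
      g * Q + n * A           ∎
    e₁ : ∀ p Q A → p * (p * 1) * (p + (suc p + 0)) * (Q * (suc p * (suc p * A)))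
                   ≡ p * p * (suc p * suc p) * ((p + suc p) * (Q * A))
    e₁ = solve-∀
    e₂ : ∀ p n g → p * p * (suc p * suc p) * (4 * (suc p * suc p) * (n * g))
                   ≡ p * (g * p) * n * (4 * (suc p * (suc p * (suc p * (suc p * 1)))))
    e₂ = solve-∀

maxNOC-lowerBound : ∀ p → 2 ≤ suc p → ∀ n m → 8 ≤ n → IsMaxNOC (suc p) n m →
  (suc p ∸ 1) ^ 2 * (2 * suc p ∸ 1) * suc p ^ n ≤ m * n * (4 * suc p ^ 4)
maxNOC-lowerBound p 2≤q n m 8≤n (_ , maximal) with block-length 2≤q n 8≤n
... | k′ , L , refl , 2n≤qᵏ , qᵏ≤2qn = ≤-trans (code-density L 2n≤qᵏ qᵏ≤2qn)
  (*-monoˡ-≤ (4 * suc p ^ 4) (*-monoˡ-≤ n (maximal (code L) (code-unique L) (code-nonOverlapping L))))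
  where open ZeroBlockCode p k′

-- (+ a) / suc b is by definition fromℚᵘ (mkℚᵘ (+ a) b).
ratio-mono : ∀ {a b c d} → 0 < b → 0 < d → a * d ≤ c * b → ratio a b ≤ℚ ratio c d
ratio-mono {a} {suc b} {c} {suc d} _ _ ad≤cb = ℚₚ.toℚᵘ-cancel-≤
  (ℚᵘₚ.≤-respˡ-≃ (ℚᵘₚ.≃-sym (ℚₚ.toℚᵘ-fromℚᵘ (mkℚᵘ (ℤ.+ a) b)))
  (ℚᵘₚ.≤-respʳ-≃ (ℚᵘₚ.≃-sym (ℚₚ.toℚᵘ-fromℚᵘ (mkℚᵘ (ℤ.+ c) d)))
    (*≤* (subst₂ ℤ._≤_ (ℤₚ.pos-* a (suc d)) (ℤₚ.pos-* c (suc b)) (ℤ.+≤+ ad≤cb)))))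

p-q≤p : ∀ x ε → Positive ε → x - ε ≤ℚ x
p-q≤p x ε ε>0 = ℚₚ.≤-trans (ℚₚ.+-monoʳ-≤ x -ε≤0) (ℚₚ.≤-reflexive (ℚₚ.+-identityʳ x))
  where
  -ε≤0 : - ε ≤ℚ 0ℚ
  -ε≤0 = ℚₚ.nonPositive⁻¹ (- ε) {{ℚₚ.neg⇒nonPos (- ε) {{ℚₚ.neg-pos {ε} ε>0}}}}

lemma3 : ∀ (q : ℕ) → 2 ≤ q →
    ∀ (ε : ℚ) → Positive ε →
    ∃[ N ] (∀ (n : ℕ) → N ≤ n → ∀ (m : ℕ) → IsMaxNOC q n m →
      (ratio ((q ∸ 1) ^ 2 * (2 * q ∸ 1)) (4 * q ^ 4) - ε) ≤ℚ ratio (m * n) (q ^ n))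
lemma3 (suc p) 2≤q ε ε>0 = 8 , λ n 8≤n m maxNOC →
  ℚₚ.≤-trans (p-q≤p _ ε ε>0)
    (ratio-mono {(suc p ∸ 1) ^ 2 * (2 * suc p ∸ 1)} {4 * suc p ^ 4} {m * n} {suc p ^ n}
      z<s (m^n>0 (suc p) n) (maxNOC-lowerBound p 2≤q n m 8≤n maxNOC))
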